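{- If every max-grounded tree is $\delta^+$-enforcible, then every grounded tree is $\delta^+$-enforcible.
   Context: Digraphs are finite, loopless, with at most one arc per ordered pair of distinct vertices. A height function of a digraph $D$ is a map $h:V(D)\to\mathbb{Z}$ with $h(v)=h(u)+1$ for every arc $(u,v)\in A(D)$. An oriented tree $T$ (a digraph whose underlying undirected graph is a tree) is a grounded tree if it admits a height function constant on $G(T):=\{x\in V(T): d_T^-(x)\ge 2\}$. A grounded tree $T$ is max-grounded if for some (equivalently every) height function $h$ of $T$, $h(x)\ge h(y)$ for all $x\in G(T)$ and $y\in V(T)$. A digraph $F$ is $\delta^+$-enforcible if there is a constant $d(F)\in\mathbb{N}$ such that every digraph of minimum out-degree at least $d(F)$ contains a subdigraph isomorphic to $F$. -}

module Defs where

open import Data.Nat using (ℕ; zero; suc; _≤_; _<_)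
open import Data.Integer as ℤ using (ℤ)
open import Data.Fin using (Fin)
open import Data.Fin.Subset using (∣_∣)
open import Data.Vec using (tabulate)
open import Data.Bool using (Bool; true; false; T)
open import Data.Sum using (_⊎_)
open import Data.Product using (Σ; ∃; _×_)
open import Data.List using (map; allFin)
open import Data.Nat.ListAction using (sum)
open import Function.Definitions using (Injective)
open import Relation.Binary.PropositionalEquality using (_≡_; _≢_)
open import Relation.Binary.Construct.Closure.ReflexiveTransitive using (Star)
open import Relation.Nullary using (¬_)

-- A finite digraph on vertex set Fin n. The arc relation is Bool-valued, so
-- there is at most one arc per ordered pair; looplessness is a field.
record Digraph : Set where
  field
    n        : ℕ
    arc      : Fin n → Fin n → Bool
    loopless : ∀ v → arc v v ≡ false

open Digraph public

Arc : (D : Digraph) → Fin (n D) → Fin (n D) → Set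
Arc D u v = T (arc D u v)

outdeg : (D : Digraph) → Fin (n D) → ℕ
outdeg D u = ∣ tabulate (λ v → arc D u v) ∣

indeg : (D : Digraph) → Fin (n D) → ℕ
indeg D v = ∣ tabulate (λ u → arc D u v) ∣

arcCount : Digraph → ℕ
arcCount D = sum (map (outdeg D) (allFin (n D)))

Adj : (D : Digraph) → Fin (n D) → Fin (n D) → Set
Adj D u v = Arc D u v ⊎ Arc D v u

Connected : Digraph → Set
Connected D = ∀ u v → Star (Adj D) u v

-- Oriented tree: the underlying undirected graph is a tree, i.e. it is a
-- simple graph (no pair of opposite arcs), nonempty, connected, and has
-- exactly |V| - 1 edges.
OrientedTree : Digraph → Set
OrientedTree D =
  (∀ u v → Arc D u v → ¬ Arc D v u) ×
  (0 < n D) ×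
  Connected D ×
  (suc (arcCount D) ≡ n D)

IsHeight : (D : Digraph) → (Fin (n D) → ℤ) → Set
IsHeight D h = ∀ u v → Arc D u v → h v ≡ h u ℤ.+ ℤ.+ 1

InG : (D : Digraph) → Fin (n D) → Set
InG D x = 2 ≤ indeg D x

Grounded : Digraph → Set
Grounded T = Σ (Fin (n T) → ℤ) λ h →
  IsHeight T h × (∀ x y → InG T x → InG T y → h x ≡ h y)

MaxGrounded : Digraph → Set
MaxGrounded T = Grounded T ×
  Σ (Fin (n T) → ℤ) λ h →
    IsHeight T h × (∀ x y → InG T x → h y ℤ.≤ h x)

Contains : Digraph → Digraph → Set
Contains D F = Σ (Fin (n F) → Fin (n D)) λ f →
  Injective _≡_ _≡_ f × (∀ u v → Arc F u v → Arc D (f u) (f v))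

Enforcible : Digraph → Set
Enforcible F = Σ ℕ λ d → ∀ (D : Digraph) → 0 < n D →
  (∀ v → d ≤ outdeg D v) → Contains D F

-- If G(T) is empty, or lies at least as high as a highest vertex y of T, then T is
-- already max-grounded. Otherwise y is strictly above G(T): it is a sink (its height is
-- maximal) of in-degree 1, i.e. a leaf hanging below a unique vertex p. Deleting y leaves
-- a grounded tree, enforcible by induction with some constant d. In a digraph of minimum
-- out-degree at least max(d, |T|), embed T − y; the image of p has an out-neighbour
-- outside the |T| − 1 used vertices, which receives y.

module Submission where

open import Algebra.Properties.CommutativeMonoid.Sum using ()
open import Data.Bool using (Bool; true; false; T; not; _∧_)
open import Data.Bool.Properties using (T-∧; ∧-identityʳ; ∧-zeroʳ)
open import Data.Fin using (Fin; zero; suc; punchIn; punchOut; _≟_)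
open import Data.Fin.Properties
  using (punchInᵢ≢i; punchIn-punchOut; punchIn-injective; nonZeroIndex; any?)
open import Data.Fin.Subset using (∣_∣)
open import Data.Integer as ℤ using (ℤ)
import Data.Integer.Properties as ℤ
open import Data.List using (map; allFin)
import Data.List as List
open import Data.List.Extrema ℤ.≤-totalOrder using (argmax; f[xs]≤f[argmax])
open import Data.List.Membership.Propositional.Properties using (∈-allFin)
import Data.List.Properties as List
import Data.List.Relation.Unary.All as All
open import Data.Nat using (ℕ; zero; suc; _+_; _⊔_; _≤_; _<_; _≤?_; z≤n; s≤s; s≤s⁻¹; >-nonZero⁻¹)
open import Data.Nat.ListAction using (sum)
open import Data.Nat.Properties
  using ( ≤-refl; ≤-trans; ≤-reflexive; ≤-antisym; ≤⇒≯; >⇒≢; ≰⇒>; m≤m+n; m≤n+m; +-monoˡ-≤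
        ; +-monoʳ-≤; m≤m⊔n; m≤n⊔m; suc-injective; +-0-commutativeMonoid; module ≤-Reasoning)
open import Data.Product using (∃; Σ; _×_; _,_; proj₁; proj₂)
open import Data.Sum as Sum using (_⊎_; inj₁; inj₂)
open import Data.Vec using (tabulate)
open import Data.Vec.Functional using (insertAt)
open import Data.Vec.Functional.Properties using (insertAt-lookup; insertAt-punchIn)
open import Data.Vec.Properties using (tabulate-cong)
open import Function using (_∘_; Equivalence)
open import Function.Definitions using (Injective)
open import Relation.Binary.Construct.Closure.ReflexiveTransitive
  using (Star; ε; _◅_; kleisliStar)
open import Relation.Binary.PropositionalEquality
open import Relation.Nullary using (¬_; yes; no; does; contradiction)
open import Relation.Nullary.Decidable using (T?; dec-true; dec-false)

open import Defs

open Algebra.Properties.CommutativeMonoid.Sum +-0-commutativeMonoid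
  using (sum-syntax; sum-remove; ∑-distrib-+; sum-cong-≗) renaming (sum to ∑)

𝟙 : Bool → ℕ
𝟙 true  = 1
𝟙 false = 0

𝟙-T : ∀ {b} → T b → 𝟙 b ≡ 1
𝟙-T {true} _ = refl

𝟙≤1 : ∀ b → 𝟙 b ≤ 1
𝟙≤1 true  = ≤-refl
𝟙≤1 false = z≤n

∣tabulate∣≡∑𝟙 : ∀ {k} (f : Fin k → Bool) → ∣ tabulate f ∣ ≡ ∑[ i < k ] 𝟙 (f i)
∣tabulate∣≡∑𝟙 {zero}  f = refl
∣tabulate∣≡∑𝟙 {suc k} f with f zero
... | true  = cong suc (∣tabulate∣≡∑𝟙 (f ∘ suc))
... | false = ∣tabulate∣≡∑𝟙 (f ∘ suc)

∣tabulate∣-punchIn : ∀ {k} (y : Fin (suc k)) (f : Fin (suc k) → Bool) →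
                     ∣ tabulate f ∣ ≡ 𝟙 (f y) + ∣ tabulate (f ∘ punchIn y) ∣
∣tabulate∣-punchIn y f = begin
  ∣ tabulate f ∣                             ≡⟨ ∣tabulate∣≡∑𝟙 f ⟩
  ∑[ i < _ ] 𝟙 (f i)                         ≡⟨ sum-remove {i = y} (𝟙 ∘ f) ⟩
  𝟙 (f y) + ∑[ i < _ ] 𝟙 (f (punchIn y i))   ≡⟨ cong (𝟙 (f y) +_) (∣tabulate∣≡∑𝟙 (f ∘ punchIn y)) ⟨
  𝟙 (f y) + ∣ tabulate (f ∘ punchIn y) ∣     ∎
  where open ≡-Reasoning

∣tabulate∣≡0 : ∀ {k} (f : Fin k → Bool) → (∀ i → ¬ T (f i)) → ∣ tabulate f ∣ ≡ 0
∣tabulate∣≡0 {zero}  f none = refl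
∣tabulate∣≡0 {suc k} f none with f zero in f₀
... | true  = contradiction (subst T (sym f₀) _) (none zero)
... | false = ∣tabulate∣≡0 (f ∘ suc) (none ∘ suc)

∣tabulate∣>0 : ∀ {k} (f : Fin k → Bool) {i} → T (f i) → 0 < ∣ tabulate f ∣
∣tabulate∣>0 {suc _} f {i} fi = begin
  1                                        ≡⟨ 𝟙-T fi ⟨
  𝟙 (f i)                                  ≤⟨ m≤m+n _ _ ⟩
  𝟙 (f i) + ∣ tabulate (f ∘ punchIn i) ∣   ≡⟨ ∣tabulate∣-punchIn i f ⟨
  ∣ tabulate f ∣                           ∎
  where open ≤-Reasoning

∣tabulate∣>0⇒∃ : ∀ {k} (f : Fin k → Bool) → 0 < ∣ tabulate f ∣ → ∃ λ i → T (f i)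
∣tabulate∣>0⇒∃ f pos with any? (T? ∘ f)
... | yes found = found
... | no  none  = contradiction (∣tabulate∣≡0 f λ i fi → none (i , fi)) (>⇒≢ pos)

∣tabulate∣<2⇒unique : ∀ {k} (f : Fin k → Bool) → ∣ tabulate f ∣ < 2 →
                      ∀ {i j} → T (f i) → T (f j) → i ≡ j
∣tabulate∣<2⇒unique {suc k} f lt {i} {j} fi fj with i ≟ j
... | yes i≡j = i≡j
... | no  i≢j = contradiction lt (≤⇒≯ (begin
  2                                        ≡⟨ cong (_+ 1) (𝟙-T fi) ⟨
  𝟙 (f i) + 1                              ≤⟨ +-monoʳ-≤ (𝟙 (f i)) (∣tabulate∣>0 (f ∘ punchIn i) fj′) ⟩
  𝟙 (f i) + ∣ tabulate (f ∘ punchIn i) ∣   ≡⟨ ∣tabulate∣-punchIn i f ⟨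
  ∣ tabulate f ∣                           ∎))
  where
  open ≤-Reasoning
  fj′ : T (f (punchIn i (punchOut i≢j)))
  fj′ = subst (T ∘ f) (sym (punchIn-punchOut i≢j)) fj

_∖_ : ∀ {k} → (Fin k → Bool) → Fin k → Fin k → Bool
(f ∖ a) i = f i ∧ not (does (i ≟ a))

∖-self : ∀ {k} (f : Fin k → Bool) a → (f ∖ a) a ≡ false
∖-self f a rewrite dec-true (a ≟ a) refl = ∧-zeroʳ (f a)

∖-punchIn : ∀ {k} (f : Fin (suc k) → Bool) a → (f ∖ a) ∘ punchIn a ≗ f ∘ punchIn a
∖-punchIn f a i rewrite dec-false (punchIn a i ≟ a) (punchInᵢ≢i a i) = ∧-identityʳ _

T-∖ : ∀ {k} (f : Fin k → Bool) a {i} → T ((f ∖ a) i) → T (f i) × i ≢ a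
T-∖ f a {i} t = proj₁ split , i≢a
  where
  split : T (f i) × T (not (does (i ≟ a)))
  split = Equivalence.to T-∧ t
  i≢a : i ≢ a
  i≢a refl = subst (T ∘ not) (dec-true (a ≟ a) refl) (proj₂ split)

∣tabulate∖∣ : ∀ {k} (f : Fin (suc k) → Bool) a →
              ∣ tabulate (f ∖ a) ∣ ≡ ∣ tabulate (f ∘ punchIn a) ∣
∣tabulate∖∣ f a = begin
  ∣ tabulate (f ∖ a) ∣                                 ≡⟨ ∣tabulate∣-punchIn a (f ∖ a) ⟩
  𝟙 ((f ∖ a) a) + ∣ tabulate ((f ∖ a) ∘ punchIn a) ∣   ≡⟨ cong₂ (λ b g → 𝟙 b + ∣ g ∣)
                                                              (∖-self f a)
                                                              (tabulate-cong (∖-punchIn f a)) ⟩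
  ∣ tabulate (f ∘ punchIn a) ∣                         ∎
  where open ≡-Reasoning

∣tabulate∣≤1+∣tabulate∖∣ : ∀ {k} (f : Fin k → Bool) a → ∣ tabulate f ∣ ≤ suc ∣ tabulate (f ∖ a) ∣
∣tabulate∣≤1+∣tabulate∖∣ {suc _} f a = begin
  ∣ tabulate f ∣                           ≡⟨ ∣tabulate∣-punchIn a f ⟩
  𝟙 (f a) + ∣ tabulate (f ∘ punchIn a) ∣   ≤⟨ +-monoˡ-≤ _ (𝟙≤1 (f a)) ⟩
  suc ∣ tabulate (f ∘ punchIn a) ∣         ≡⟨ cong suc (∣tabulate∖∣ f a) ⟨
  suc ∣ tabulate (f ∖ a) ∣                 ∎
  where open ≤-Reasoning

∃-outside-image : ∀ {k m} (f : Fin k → Bool) (g : Fin m → Fin k) → m < ∣ tabulate f ∣ →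
                  ∃ λ w → T (f w) × ∀ i → g i ≢ w
∃-outside-image {m = zero} f g pos with ∣tabulate∣>0⇒∃ f pos
... | w , fw = w , fw , λ ()
∃-outside-image {m = suc m} f g lt
  with ∃-outside-image (f ∖ g zero) (g ∘ suc) (s≤s⁻¹ (≤-trans lt (∣tabulate∣≤1+∣tabulate∖∣ f (g zero))))
... | w , f∖w , fresh with T-∖ f (g zero) f∖w
... | fw , w≢g₀ = w , fw , λ { zero → w≢g₀ ∘ sym ; (suc i) → fresh i }

sum-allFin≡∑ : ∀ {k} (g : Fin k → ℕ) → sum (map g (allFin k)) ≡ ∑[ i < k ] g i
sum-allFin≡∑ {zero}  g = refl
sum-allFin≡∑ {suc k} g = cong (g zero +_) (begin
  sum (map g (List.tabulate suc))      ≡⟨ cong sum (List.map-tabulate suc g) ⟩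
  sum (List.tabulate (g ∘ suc))        ≡⟨ cong sum (List.map-tabulate (λ i → i) (g ∘ suc)) ⟨
  sum (map (g ∘ suc) (allFin k))       ≡⟨ sum-allFin≡∑ (g ∘ suc) ⟩
  ∑[ i < k ] g (suc i)                 ∎)
  where open ≡-Reasoning

data PunchView {k} (y : Fin (suc k)) : Fin (suc k) → Set where
  pivot   : PunchView y y
  punched : ∀ u → PunchView y (punchIn y u)

punchView : ∀ {k} (y v : Fin (suc k)) → PunchView y v
punchView y v with y ≟ v
... | yes refl = pivot
... | no  y≢v  = subst (PunchView y) (punchIn-punchOut y≢v) (punched (punchOut y≢v))

Star-last : ∀ {A : Set} {R : A → A → Set} {x z} → Star R x z → x ≡ z ⊎ ∃ λ c → R c z
Star-last ε = inj₁ refl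
Star-last (r ◅ rs) with Star-last rs
... | inj₁ refl = inj₂ (_ , r)
... | inj₂ last = inj₂ last

highest : ∀ {k} (h : Fin (suc k) → ℤ) → ∃ λ y → ∀ v → h v ℤ.≤ h y
highest {k} h = argmax h zero (allFin (suc k)) ,
  λ v → All.lookup (f[xs]≤f[argmax] {f = h} zero (allFin (suc k))) (∈-allFin v)

highest-sink : (D : Digraph) {h : Fin (n D) → ℤ} → IsHeight D h →
               ∀ {y} → (∀ v → h v ℤ.≤ h y) → ∀ v → ¬ Arc D y v
highest-sink D {h} h-height {y} y-highest v y→v =
  ℤ.<⇒≱ (i<i+1 (h y)) (subst (ℤ._≤ h y) (h-height y v y→v) (y-highest v))
  where
  i<i+1 : ∀ i → i ℤ.< i ℤ.+ ℤ.+ 1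
  i<i+1 i = subst (ℤ._< i ℤ.+ ℤ.+ 1) (ℤ.+-identityʳ i) (ℤ.+-monoʳ-< i (ℤ.+<+ (s≤s z≤n)))

digraph : ∀ {k} (a : Fin k → Fin k → Bool) → (∀ v → a v v ≡ false) → Digraph
digraph a a-loopless = record { n = _ ; arc = a ; loopless = a-loopless }

module Deletion {k : ℕ} (a : Fin (suc k) → Fin (suc k) → Bool)
                (a-loopless : ∀ v → a v v ≡ false) (y : Fin (suc k)) where

  D : Digraph
  D = digraph a a-loopless

  D─y : Digraph
  D─y = digraph (λ u v → a (punchIn y u) (punchIn y v)) (a-loopless ∘ punchIn y)

  into-y : Fin k → Bool
  into-y u = a (punchIn y u) y

  outdeg-punchIn : ∀ u → outdeg D (punchIn y u) ≡ 𝟙 (into-y u) + outdeg D─y u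
  outdeg-punchIn u = ∣tabulate∣-punchIn y (a (punchIn y u))

  indeg-punchIn : ∀ u → indeg D (punchIn y u) ≡ 𝟙 (a y (punchIn y u)) + indeg D─y u
  indeg-punchIn u = ∣tabulate∣-punchIn y (λ w → a w (punchIn y u))

  indeg≡∑ : indeg D y ≡ ∑[ u < k ] 𝟙 (into-y u)
  indeg≡∑ = begin
    indeg D y                                 ≡⟨ ∣tabulate∣-punchIn y (λ w → a w y) ⟩
    𝟙 (a y y) + ∣ tabulate into-y ∣            ≡⟨ cong (λ b → 𝟙 b + ∣ tabulate into-y ∣) (a-loopless y) ⟩
    ∣ tabulate into-y ∣                        ≡⟨ ∣tabulate∣≡∑𝟙 into-y ⟩
    ∑[ u < k ] 𝟙 (into-y u)                   ∎
    where open ≡-Reasoning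

  arcCount-split : arcCount D ≡ outdeg D y + (indeg D y + arcCount D─y)
  arcCount-split = begin
    arcCount D                                          ≡⟨ sum-allFin≡∑ (outdeg D) ⟩
    ∑[ u < suc k ] outdeg D u                           ≡⟨ sum-remove {i = y} (outdeg D) ⟩
    outdeg D y + ∑[ u < k ] outdeg D (punchIn y u)      ≡⟨ cong (outdeg D y +_) rest ⟩
    outdeg D y + (indeg D y + arcCount D─y)             ∎
    where
    open ≡-Reasoning
    rest : ∑[ u < k ] outdeg D (punchIn y u) ≡ indeg D y + arcCount D─y
    rest = begin
      ∑[ u < k ] outdeg D (punchIn y u)                   ≡⟨ sum-cong-≗ outdeg-punchIn ⟩
      ∑[ u < k ] (𝟙 (into-y u) + outdeg D─y u)             ≡⟨ ∑-distrib-+ (𝟙 ∘ into-y) (outdeg D─y) ⟩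
      ∑[ u < k ] 𝟙 (into-y u) + ∑[ u < k ] outdeg D─y u    ≡⟨ cong₂ _+_ indeg≡∑ (sum-allFin≡∑ (outdeg D─y)) ⟨
      indeg D y + arcCount D─y                            ∎

  grounded-─ : Grounded D → Grounded D─y
  grounded-─ (h , h-height , h-level) =
    h ∘ punchIn y , (λ u v → h-height (punchIn y u) (punchIn y v)) ,
    λ u v u∈G v∈G → h-level (punchIn y u) (punchIn y v) (G-punchIn u∈G) (G-punchIn v∈G)
    where
    G-punchIn : ∀ {u} → InG D─y u → InG D (punchIn y u)
    G-punchIn {u} u∈G = ≤-trans u∈G (≤-trans (m≤n+m _ _) (≤-reflexive (sym (indeg-punchIn u))))

  IsOutLeaf : Fin k → Set
  IsOutLeaf p = (∀ v → ¬ Arc D y v) × Arc D (punchIn y p) y × indeg D y < 2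

  module OutLeaf (p : Fin k) (y-sink : ∀ v → ¬ Arc D y v) (p→y : Arc D (punchIn y p) y)
                 (y-indeg : indeg D y < 2) where

    in-neighbour-unique : ∀ {u} → Arc D u y → u ≡ punchIn y p
    in-neighbour-unique u→y = ∣tabulate∣<2⇒unique (λ w → a w y) y-indeg u→y p→y

    neighbour-unique : ∀ {v} → Adj D y v → v ≡ punchIn y p
    neighbour-unique (inj₁ y→v) = contradiction y→v (y-sink _)
    neighbour-unique (inj₂ v→y) = in-neighbour-unique v→y

    arcCount-─ : arcCount D ≡ suc (arcCount D─y)
    arcCount-─ = begin
      arcCount D                                ≡⟨ arcCount-split ⟩
      outdeg D y + (indeg D y + arcCount D─y)   ≡⟨ cong₂ (λ o i → o + (i + arcCount D─y)) outdeg≡0 indeg≡1 ⟩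
      suc (arcCount D─y)                        ∎
      where
      open ≡-Reasoning
      outdeg≡0 : outdeg D y ≡ 0
      outdeg≡0 = ∣tabulate∣≡0 (a y) y-sink
      indeg≡1 : indeg D y ≡ 1
      indeg≡1 = ≤-antisym (s≤s⁻¹ y-indeg) (∣tabulate∣>0 (λ w → a w y) p→y)

    -- Merges y into p; as p is the only neighbour of y, an edge at y collapses to a point.
    collapse : Fin (suc k) → Fin k
    collapse = insertAt (λ u → u) y p

    collapse-punchIn : ∀ u → collapse (punchIn y u) ≡ u
    collapse-punchIn = insertAt-punchIn (λ u → u) y p

    collapse-step : ∀ {s t} → Adj D s t → Star (Adj D─y) (collapse s) (collapse t)
    collapse-step {s} {t} s~t with punchView y s | punchView y t
    ... | pivot     | pivot     = ε
    ... | pivot     | punched v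
      rewrite insertAt-lookup (λ u → u) y p | collapse-punchIn v
            | punchIn-injective y v p (neighbour-unique s~t) = ε
    ... | punched u | pivot
      rewrite insertAt-lookup (λ u → u) y p | collapse-punchIn u
            | punchIn-injective y u p (neighbour-unique (Sum.swap s~t)) = ε
    ... | punched u | punched v
      rewrite collapse-punchIn u | collapse-punchIn v = s~t ◅ ε

    connected-─ : Connected D → Connected D─y
    connected-─ connected u v =
      subst₂ (Star (Adj D─y)) (collapse-punchIn u) (collapse-punchIn v)
        (kleisliStar collapse collapse-step (connected (punchIn y u) (punchIn y v)))

    orientedTree-─ : OrientedTree D → OrientedTree D─y
    orientedTree-─ (antisymmetric , _ , connected , edges) =
      (λ u v → antisymmetric (punchIn y u) (punchIn y v)) ,
      >-nonZero⁻¹ k {{nonZeroIndex p}} ,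
      connected-─ connected ,
      suc-injective (trans (cong suc (sym arcCount-─)) edges)

    extend : (H : Digraph) (emb : Contains H D─y) → k < outdeg H (proj₁ emb p) → Contains H D
    extend H (f , f-injective , f-arcs) fp-outdeg with ∃-outside-image (arc H (f p)) f fp-outdeg
    ... | w , fp→w , w-fresh = F , F-injective , F-arcs
      where
      F : Fin (suc k) → Fin (n H)
      F = insertAt f y w

      F-injective : Injective _≡_ _≡_ F
      F-injective {u} {v} Fu≡Fv with punchView y u | punchView y v
      ... | pivot | pivot = refl
      ... | pivot | punched v′
        rewrite insertAt-lookup f y w | insertAt-punchIn f y w v′ =
          contradiction (sym Fu≡Fv) (w-fresh v′)
      ... | punched u′ | pivot
        rewrite insertAt-lookup f y w | insertAt-punchIn f y w u′ =
          contradiction Fu≡Fv (w-fresh u′)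
      ... | punched u′ | punched v′
        rewrite insertAt-punchIn f y w u′ | insertAt-punchIn f y w v′ =
          cong (punchIn y) (f-injective Fu≡Fv)

      F-arcs : ∀ u v → Arc D u v → Arc H (F u) (F v)
      F-arcs u v u→v with punchView y u | punchView y v
      ... | pivot | _ = contradiction u→v (y-sink v)
      ... | punched u′ | pivot
        rewrite insertAt-lookup f y w | insertAt-punchIn f y w u′
              | punchIn-injective y u′ p (in-neighbour-unique u→v) = fp→w
      ... | punched u′ | punched v′
        rewrite insertAt-punchIn f y w u′ | insertAt-punchIn f y w v′ = f-arcs u′ v′ u→v

    enforcible-─ : Enforcible D─y → Enforcible D
    enforcible-─ (d , enforce) = d ⊔ suc k , λ H H-nonempty δ⁺≥ →
      extend H (enforce H H-nonempty (λ v → ≤-trans (m≤m⊔n d _) (δ⁺≥ v)))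
               (≤-trans (m≤n⊔m d _) (δ⁺≥ _))

sink-in-neighbour :
  ∀ {k} (a : Fin (suc k) → Fin (suc k) → Bool) (a-loopless : ∀ v → a v v ≡ false) {x y} →
  let D = digraph a a-loopless in
  Connected D → x ≢ y → (∀ v → ¬ Arc D y v) → Σ (Fin k) λ p → Arc D (punchIn y p) y
sink-in-neighbour a a-loopless {x} {y} connected x≢y y-sink with Star-last (connected x y)
... | inj₁ x≡y = contradiction x≡y x≢y
... | inj₂ (c , c~y) with punchView y c | c~y
...   | _         | inj₂ y→c = contradiction y→c (y-sink c)
...   | pivot     | inj₁ y→y = contradiction y→y (y-sink y)
...   | punched p | inj₁ p→y = p , p→y

highest-isOutLeaf :
  ∀ {k} (a : Fin (suc k) → Fin (suc k) → Bool) (a-loopless : ∀ v → a v v ≡ false) {h x y} →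
  let D = digraph a a-loopless in
  Connected D → IsHeight D h → (∀ v → h v ℤ.≤ h y) → ¬ InG D y → x ≢ y →
  Σ (Fin k) (Deletion.IsOutLeaf a a-loopless y)
highest-isOutLeaf a a-loopless connected h-height y-highest y∉G x≢y =
  let y-sink = highest-sink (digraph a a-loopless) h-height y-highest
      p , p→y = sink-in-neighbour a a-loopless connected x≢y y-sink
  in p , y-sink , p→y , ≰⇒> y∉G

maxGrounded-or-outLeaf :
  ∀ {k} (a : Fin (suc k) → Fin (suc k) → Bool) (a-loopless : ∀ v → a v v ≡ false) →
  let D = digraph a a-loopless in
  OrientedTree D → Grounded D →
  MaxGrounded D ⊎ Σ (Fin (suc k)) λ y → Σ (Fin k) (Deletion.IsOutLeaf a a-loopless y)
maxGrounded-or-outLeaf a a-loopless (_ , _ , connected , _) grounded@(h , h-height , h-level)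
  with any? (λ x → 2 ≤? indeg (digraph a a-loopless) x)
... | no G-empty =
  inj₁ (grounded , h , h-height , λ x _ x∈G → contradiction (x , x∈G) G-empty)
... | yes (x₀ , x₀∈G) with highest h
...   | y , y-highest with h y ℤ.≤? h x₀
...     | yes y≤x₀ = inj₁ (grounded , h , h-height , λ x v x∈G →
            ℤ.≤-trans (y-highest v) (subst (h y ℤ.≤_) (h-level x₀ x x₀∈G x∈G) y≤x₀))
...     | no  y≰x₀ = inj₂ (y , highest-isOutLeaf a a-loopless connected h-height y-highest
            (λ y∈G → y≰x₀ (ℤ.≤-reflexive (h-level y x₀ y∈G x₀∈G)))
            (λ x₀≡y → y≰x₀ (ℤ.≤-reflexive (cong h (sym x₀≡y)))))

module _ (max-enforcible : ∀ (T : Digraph) → OrientedTree T → MaxGrounded T → Enforcible T) where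

  grounded-enforcible :
    ∀ {k} (a : Fin k → Fin k → Bool) (a-loopless : ∀ v → a v v ≡ false) →
    let D = digraph a a-loopless in
    OrientedTree D → Grounded D → Enforcible D
  grounded-enforcible {zero} a a-loopless (_ , () , _) grounded
  grounded-enforcible {suc k} a a-loopless tree grounded
    with maxGrounded-or-outLeaf a a-loopless tree grounded
  ... | inj₁ maxGrounded = max-enforcible (digraph a a-loopless) tree maxGrounded
  ... | inj₂ (y , p , y-sink , p→y , y-indeg) =
    enforcible-─ (grounded-enforcible {k} (arc D─y) (loopless D─y)
                                      (orientedTree-─ tree) (grounded-─ grounded))
    where
    open Deletion a a-loopless y
    open OutLeaf p y-sink p→y y-indeg

-- T is definitionally digraph (arc T) (loopless T), by η for records.
mainTheorem10 : (∀ (T : Digraph) → OrientedTree T → MaxGrounded T → Enforcible T) →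
                ∀ (T : Digraph) → OrientedTree T → Grounded T → Enforcible T
mainTheorem10 max-enforcible T = grounded-enforcible max-enforcible (arc T) (loopless T)
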